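{- Consider the Swapping Algorithm for a finite family $\mathcal B$ of bad-events on permutations $\pi_1,\dots,\pi_N$, and let $\pi_k^t$ denote the value of $\pi_k$ after $t$ iterations. Suppose that for some times $t_0<t_2$ and some $k,X,Y$ we have $\pi_k^{t_0}(X)\ne Y$ and $\pi_k^{t_2}(X)=Y$. Then there is some time $t_1$ with $t_0\le t_1<t_2$ such that the bad-event resampled in iteration $t_1+1$ (the iteration transforming $\pi^{t_1}$ into $\pi^{t_1+1}$) contains a triple of the form $(k,X,y)$ for some $y$, or a triple of the form $(k,x,Y)$ for some $x$.
   Context: $\pi_k$ is a permutation of $[n_k]$. A bad-event $B$ is a finite set of triples $(k,x,y)$, $x,y\in[n_k]$, with no two triples $(k,x,y),(k,x,y')$, $y\ne y'$, and no two $(k,x,y),(k,x',y)$, $x\ne x'$; $B$ is true iff $\pi_k(x)=y$ for all $(k,x,y)\in B$. $\mathrm{Swap}(\pi;x_1,\dots,x_r)$ for a permutation $\pi$ of $[t]$ and distinct $x_i$: for $i=1,\dots,r$, choose $x_i'$ uniformly from $[t]\setminus\{x_1,\dots,x_{i-1}\}$ and exchange the values of $\pi$ at positions $x_i,x_i'$. Swapping Algorithm: choose $\pi_1,\dots,\pi_N$ independently uniformly (giving $\pi^0$); while some $B\in\mathcal B$ is true, pick an arbitrary true $B$ and for each $k$ with triples $(k,x_1,y_1),\dots,(k,x_r,y_r)$ in $B$ replace $\pi_k$ by $\mathrm{Swap}(\pi_k;x_1,\dots,x_r)$; each such iteration increments time by one. -}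

module Defs where

open import Data.Nat using (ℕ; suc; _≤_; _<_)
open import Data.Fin using (Fin; _≟_)
open import Data.Product using (_×_; _,_; proj₁; proj₂; Σ; ∃)
open import Data.Sum using (_⊎_)
open import Data.List using (List; []; _∷_; _++_; [_]; map)
open import Data.List.Membership.Propositional using (_∈_; _∉_)
open import Data.List.Relation.Unary.All using (All)
open import Data.List.Relation.Unary.Any using (Any)
open import Data.List.Relation.Unary.Unique.Propositional using (Unique)
open import Relation.Binary.PropositionalEquality using (_≡_)
open import Relation.Nullary using (yes; no)
open import Function.Definitions using (Bijective)

swapAt : {t : ℕ} → (Fin t → Fin t) → Fin t → Fin t → (Fin t → Fin t)
swapAt π a b i with i ≟ a
... | yes _ = π b
... | no _ with i ≟ b
...   | yes _ = π a
...   | no _ = π i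

-- SwapFrom used π xs π' : π' is a possible outcome of continuing
-- Swap(π; x_1,...,x_r) where 'used' = [x_1,...,x_{i-1}] are the already
-- processed positions and xs = [x_i,...,x_r] the remaining ones; at each step
-- x_i' is any element of [t] \ {x_1,...,x_{i-1}}.
data SwapFrom {t : ℕ} (used : List (Fin t)) :
       (Fin t → Fin t) → List (Fin t) → (Fin t → Fin t) → Set where
  done : ∀ {π} → SwapFrom used π [] π
  step : ∀ {π x xs π'} (x' : Fin t) → x' ∉ used →
         SwapFrom (used ++ [ x ]) (swapAt π x x') xs π' →
         SwapFrom used π (x ∷ xs) π'

SwapOutcome : {t : ℕ} → (Fin t → Fin t) → List (Fin t) → (Fin t → Fin t) → Set
SwapOutcome π xs π' = SwapFrom [] π xs π'

module SwappingAlgorithm (N : ℕ) (n : Fin N → ℕ) where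

  State : Set
  State = (k : Fin N) → Fin (n k) → Fin (n k)

  record BadEvent : Set where
    field
      triples : (k : Fin N) → List (Fin (n k) × Fin (n k))
      xs-distinct : (k : Fin N) → Unique (map proj₁ (triples k))
      ys-distinct : (k : Fin N) → Unique (map proj₂ (triples k))
  open BadEvent public

  IsTrue : BadEvent → State → Set
  IsTrue B π = (k : Fin N) → All (λ p → π k (proj₁ p) ≡ proj₂ p) (triples B k)

  Resample : BadEvent → State → State → Set
  Resample B π π' = (k : Fin N) → SwapOutcome (π k) (map proj₁ (triples B k)) (π' k)

  -- A run of the Swapping Algorithm for family 𝓑 with T iterations:
  -- states π t (t ≤ T) and resampled events ev t (iteration t+1, t < T).
  record Run (𝓑 : List BadEvent) (T : ℕ) : Set where
    field
      π : ℕ → State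
      ev : ℕ → BadEvent
      initial-perm : (k : Fin N) → Bijective _≡_ _≡_ (π 0 k)
      ev-in : ∀ t → t < T → ev t ∈ 𝓑
      ev-true : ∀ t → t < T → IsTrue (ev t) (π t)
      ev-step : ∀ t → t < T → Resample (ev t) (π t) (π (suc t))
  open Run public

-- A swap at x with x' changes π only at x and x', where it puts π(x') and π(x).
-- So if neither X nor any position x still to be processed holds Y, and X itself
-- is never processed, then X never comes to hold Y.  When the resampled event B
-- has no triple (k, X, _), X is not processed; when it has no triple (k, _, Y),
-- truth of B says π_k(x) = y ≠ Y at every processed x.  Hence the last iteration
-- before π_k(X) becomes Y resamples an event mentioning X or Y.
module Submission where

open import Defs
open import Data.Nat using (ℕ; zero; suc; _≤_; _<_; z≤n; s≤s)
open import Data.Nat.Properties using (≤-refl; ≤-trans; <⇒≤; m≤n⇒m<n∨m≡n; m<n⇒m<1+n)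
open import Data.Fin using (Fin; _≟_)
open import Function using (_∘_)
open import Data.Product using (_×_; Σ; proj₁; proj₂; _,_)
open import Data.Sum using (_⊎_; inj₁; inj₂)
open import Data.List using (List; map)
open import Data.List.Relation.Unary.All as All using (All; _∷_)
open import Data.List.Relation.Unary.All.Properties using (¬Any⇒All¬)
import Data.List.Relation.Unary.All.Properties as All
open import Data.List.Relation.Unary.Any as Any using (Any; any?)
import Data.List.Relation.Unary.Any.Properties as Any
open import Data.List.Relation.Unary.AllPairs using (_∷_)
open import Data.List.Relation.Unary.Unique.Propositional using (Unique)
open import Data.List.Membership.Propositional using (_∉_)
open import Relation.Binary.PropositionalEquality using (_≡_; _≢_; refl; sym; trans)
open import Relation.Nullary using (¬_; Dec; yes; no; contradiction)
open import Relation.Nullary.Decidable using (_⊎-dec_)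

module _ {t : ℕ} {Y : Fin t} where

  swapAt-≢ : ∀ (π : Fin t → Fin t) {x p} x' → p ≢ x →
             π x ≢ Y → π p ≢ Y → swapAt π x x' p ≢ Y
  swapAt-≢ π {x} {p} x' p≢x πx≢Y πp≢Y with p ≟ x
  ... | yes p≡x = contradiction p≡x p≢x
  ... | no _ with p ≟ x'
  ...   | yes _ = πx≢Y
  ...   | no _  = πp≢Y

  swapFrom-≢ : ∀ {used π xs π'} → SwapFrom used π xs π' → Unique xs →
               All (λ p → π p ≢ Y) xs → ∀ {X} → X ∉ xs → π X ≢ Y → π' X ≢ Y
  swapFrom-≢ done _ _ _ πX≢Y = πX≢Y
  swapFrom-≢ {π = π} (step x' _ rest) (x≢xs ∷ unique) (πx≢Y ∷ πxs≢Y) X∉ πX≢Y =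
    swapFrom-≢ rest unique
      (All.zipWith (λ (πp≢Y , x≢p) → swapAt-≢ π x' (x≢p ∘ sym) πx≢Y πp≢Y) (πxs≢Y , x≢xs))
      (X∉ ∘ Any.there)
      (swapAt-≢ π x' (X∉ ∘ Any.here) πx≢Y πX≢Y)

broken-invariant-cause : ∀ {P Q : ℕ → Set} {t₀ t₂} → (∀ t → Dec (Q t)) →
  (∀ t → t < t₂ → P t → ¬ Q t → P (suc t)) →
  t₀ ≤ t₂ → P t₀ → ¬ P t₂ → Σ ℕ (λ t₁ → t₀ ≤ t₁ × t₁ < t₂ × Q t₁)
broken-invariant-cause {t₂ = zero} _ _ z≤n P0 ¬P0 = contradiction P0 ¬P0
broken-invariant-cause {t₂ = suc s} Q? keep t₀≤t₂ Pt₀ ¬Pt₂ with m≤n⇒m<n∨m≡n t₀≤t₂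
... | inj₂ refl = contradiction Pt₀ ¬Pt₂
... | inj₁ (s≤s t₀≤s) with Q? s
...   | yes Qs = s , t₀≤s , ≤-refl , Qs
...   | no ¬Qs =
  let t₁ , t₀≤t₁ , t₁<s , Qt₁ = broken-invariant-cause Q? (λ t → keep t ∘ m<n⇒m<1+n) t₀≤s Pt₀
                                  (λ Ps → ¬Pt₂ (keep s ≤-refl Ps ¬Qs))
  in t₁ , t₀≤t₁ , m<n⇒m<1+n t₁<s , Qt₁

module _ {N : ℕ} {n : Fin N → ℕ} where
  open SwappingAlgorithm N n

  Mentions : BadEvent → (k : Fin N) → Fin (n k) → Fin (n k) → Set
  Mentions B k X Y = Any (λ p → proj₁ p ≡ X) (triples B k) ⊎ Any (λ p → proj₂ p ≡ Y) (triples B k)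

  mentions? : ∀ B k X Y → Dec (Mentions B k X Y)
  mentions? B k X Y = any? (λ p → proj₁ p ≟ X) (triples B k) ⊎-dec any? (λ p → proj₂ p ≟ Y) (triples B k)

  resample-preserves-≢ : ∀ {B π π'} k {X Y} → IsTrue B π → Resample B π π' →
                         ¬ Mentions B k X Y → π k X ≢ Y → π' k X ≢ Y
  resample-preserves-≢ {B} {π} k {X} {Y} true resample ¬mentions =
    swapFrom-≢ (resample k) (xs-distinct B k) swapped≢Y X∉swapped
    where
    X∉swapped : X ∉ map proj₁ (triples B k)
    X∉swapped X∈ = ¬mentions (inj₁ (Any.map sym (Any.map⁻ X∈)))

    swapped≢Y : All (λ x → π k x ≢ Y) (map proj₁ (triples B k))
    swapped≢Y = All.map⁺ (All.zipWith (λ (πx≡y , y≢Y) πx≡Y → y≢Y (trans (sym πx≡y) πx≡Y))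
                                      (true k , ¬Any⇒All¬ _ (¬mentions ∘ inj₂)))

proposition3p2 : (N : ℕ) (n : Fin N → ℕ) (𝓑 : List (SwappingAlgorithm.BadEvent N n)) (T : ℕ) (R : SwappingAlgorithm.Run N n 𝓑 T) (t₀ t₂ : ℕ) (k : Fin N) (X Y : Fin (n k))
    → t₀ < t₂ → t₂ ≤ T
    → ¬ (SwappingAlgorithm.π R t₀ k X ≡ Y)
    → SwappingAlgorithm.π R t₂ k X ≡ Y
    → Σ ℕ (λ t₁ → (t₀ ≤ t₁) × (t₁ < t₂)
        × (Any (λ p → proj₁ p ≡ X) (SwappingAlgorithm.triples (SwappingAlgorithm.ev R t₁) k)
           ⊎ Any (λ p → proj₂ p ≡ Y) (SwappingAlgorithm.triples (SwappingAlgorithm.ev R t₁) k)))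
proposition3p2 N n 𝓑 T R t₀ t₂ k X Y t₀<t₂ t₂≤T πt₀X≢Y πt₂X≡Y =
  broken-invariant-cause (λ t → mentions? (ev R t) k X Y) preserved (<⇒≤ t₀<t₂) πt₀X≢Y (λ ≢ → ≢ πt₂X≡Y)
  where
  open SwappingAlgorithm N n

  preserved : ∀ t → t < t₂ → π R t k X ≢ Y → ¬ Mentions (ev R t) k X Y → π R (suc t) k X ≢ Y
  preserved t t<t₂ ≢Y ¬mentions =
    resample-preserves-≢ {B = ev R t} k (ev-true R t t<T) (ev-step R t t<T) ¬mentions ≢Y
    where
    t<T : t < T
    t<T = ≤-trans t<t₂ t₂≤T
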